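{- Let $A=\langle n_0^{\beta_0}\rangle\cdots\langle n_k^{\beta_k}\rangle\top\in\mathrm{INF}$. Then there is $\psi\in\mathrm{MNF}$ such that $A\equiv\psi$ in $\mathbf{TSC}$ and $\psi=\langle n_0^{\alpha_0}\rangle\top\wedge\cdots\wedge\langle n_k^{\alpha_k}\rangle\top$, where $\alpha_k=\beta_k$ and, for all $0\le i<k$, $\alpha_i=e^{n_{i+1}-n_i}(\alpha_{i+1})\cdot(1+\beta_i)$.
   Context: Ordinals range below $\varepsilon_0$. $\mathbb{F}_{\varepsilon_0}$ is the least set containing $\top$, closed under $\wedge$ and under unary modalities $\langle n^\alpha\rangle$ ($n<\omega$, $\alpha<\varepsilon_0$); $\langle n^0\rangle\varphi$ denotes $\varphi$. An ordinal worm is a formula $\langle m_0^{\gamma_0}\rangle\cdots\langle m_j^{\gamma_j}\rangle\top$ (including $\top$). INF (increasing normal forms): $\top$ and worms built by prefixing $\langle n^\alpha\rangle$ with $0<\alpha$ to a worm in INF whose first modality $\langle m^\beta\rangle$ has $n<m$ (so the bases strictly increase from left to right). Hyper-exponentials: $e^0=\mathrm{id}$, $e^1(\alpha)=-1+\omega^\alpha$, $e^{n+m}=e^n\circ e^m$. MNF is the least set with: $\top\in$ MNF; each monomial $\langle n^\alpha\rangle\top\in$ MNF; if $\langle n_0^{\alpha_0}\rangle\top\wedge\cdots\wedge\langle n_k^{\alpha_k}\rangle\top\in$ MNF, $n<n_0$, and $\alpha=e^{n_0-n}(\alpha_0)\cdot(2+\beta)$ for some $\beta<\varepsilon_0$,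 then $\langle n^\alpha\rangle\top\wedge\langle n_0^{\alpha_0}\rangle\top\wedge\cdots\wedge\langle n_k^{\alpha_k}\rangle\top\in$ MNF. $\mathbf{TSC}$ derives sequents $\varphi\vdash\psi$; $\varphi\equiv\psi$ means both directions derivable. Axioms: $\varphi\vdash\varphi$; $\varphi\vdash\top$; $\varphi\wedge\psi\vdash\varphi$; $\varphi\wedge\psi\vdash\psi$; $\langle n^\alpha\rangle\varphi\vdash\langle n^\beta\rangle\varphi$ for $\beta\le\alpha$; $\langle n^{\alpha+\beta}\rangle\varphi\equiv\langle n^\beta\rangle\langle n^\alpha\rangle\varphi$; $\langle(m+n)^\alpha\rangle\varphi\vdash\langle m^{e^n(\alpha)}\rangle\varphi$; Schmerl axioms $\langle n^\alpha\rangle(\langle n_0^{\alpha_0}\rangle\top\wedge\cdots\wedge\langle n_k^{\alpha_k}\rangle\top)\equiv\langle n^{e^{n_0-n}(\alpha_0)\cdot(1+\alpha)}\rangle\top\wedge\langle n_0^{\alpha_0}\rangle\top\wedge\cdots\wedge\langle n_k^{\alpha_k}\rangle\top$ for $n<n_0$ and the conjunction in MNF. Rules: from $\varphi\vdash\psi$, $\varphi\vdash\chi$ infer $\varphi\vdash\psi\wedge\chi$; from $\varphi\vdash\psi$, $\psi\vdash\chi$ infer $\varphi\vdash\chi$; from $\varphi\vdash\psi$ infer $\langle n^\alpha\rangle\varphi\vdash\langle n^\alpha\rangle\psi$; from $\varphi\vdash\psi$ infer $\langle n^\alpha\rangle\varphi\wedge\langle m^{\beta+1}\rangle\psi\vdash\langle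 n^\alpha\rangle(\varphi\wedge\langle m^{\beta+1}\rangle\psi)$ for $m<n$. -}

module Defs where

open import Data.Nat using (ℕ; zero; suc; _∸_; _<_)
open import Data.Bool using (Bool; true; false; T; not)
open import Data.List using (List; []; _∷_)
open import Data.Product using (_×_; _,_; Σ)
open import Relation.Binary.PropositionalEquality using (_≡_)
open import Relation.Nullary using (¬_)

-- Ordinals below ε₀ as Cantor-normal-form expressions.
-- A term  ω^ a + b  denotes the ordinal  ω^⟦a⟧ + ⟦b⟧ .  Every term
-- denotes an ordinal < ε₀ and every ordinal < ε₀ is denoted by a term
-- in Cantor normal form (exponents non-increasing).  All arithmetic
-- below first normalises its arguments (nf), so operations are correct
-- on arbitrary terms; order and equality of ordinals are the semantic
-- ones (compare normal forms).

data Ord : Set where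
  𝟎    : Ord
  ω^_+_ : Ord → Ord → Ord

data Cmp : Set where
  lt eq gt : Cmp

cmp : Ord → Ord → Cmp
cmp 𝟎 𝟎 = eq
cmp 𝟎 (ω^ _ + _) = lt
cmp (ω^ _ + _) 𝟎 = gt
cmp (ω^ a + b) (ω^ c + d) with cmp a c
... | lt = lt
... | gt = gt
... | eq = cmp b d

_⊕_ : Ord → Ord → Ord
𝟎 ⊕ y = y
(ω^ a + b) ⊕ 𝟎 = ω^ a + b
(ω^ a + b) ⊕ (ω^ c + d) with cmp a c
... | lt = ω^ c + d
... | _  = ω^ a + (b ⊕ (ω^ c + d))

nf : Ord → Ord
nf 𝟎 = 𝟎
nf (ω^ a + b) = (ω^ nf a + 𝟎) ⊕ nf b

-- multiplication of terms in Cantor normal form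
-- (x · (ω^c + d) = x · ω^c + x · d ; x · ω^0 = x ; x · ω^c = ω^(a+c) for c > 0)
_⊗_ : Ord → Ord → Ord
𝟎 ⊗ _ = 𝟎
(ω^ a + b) ⊗ 𝟎 = 𝟎
(ω^ a + b) ⊗ (ω^ 𝟎 + d) = (ω^ a + b) ⊕ ((ω^ a + b) ⊗ d)
(ω^ a + b) ⊗ (ω^ (ω^ c₁ + c₂) + d) =
  (ω^ (a ⊕ (ω^ c₁ + c₂)) + 𝟎) ⊕ ((ω^ a + b) ⊗ d)

infixl 6 _+o_
infixl 7 _·o_

_+o_ : Ord → Ord → Ord
a +o b = nf a ⊕ nf b

_·o_ : Ord → Ord → Ord
a ·o b = nf a ⊗ nf b

isGt : Cmp → Bool
isGt gt = true
isGt _  = false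

_≤o_ : Ord → Ord → Set
a ≤o b = T (not (isGt (cmp (nf a) (nf b))))

_≈o_ : Ord → Ord → Set
a ≈o b = nf a ≡ nf b

Pos : Ord → Set
Pos a = ¬ (a ≈o 𝟎)

one two : Ord
one = ω^ 𝟎 + 𝟎
two = ω^ 𝟎 + one

-- e¹(α) = -1 + ω^α  (= 0 if α = 0, and ω^α otherwise)
e1 : Ord → Ord
e1 a with nf a
... | 𝟎 = 𝟎
... | ω^ c + d = ω^ (ω^ c + d) + 𝟎

e : ℕ → Ord → Ord
e zero a = a
e (suc n) a = e1 (e n a)

infixr 6 _∧_
data Fm : Set where
  ⊤      : Fm
  _∧_    : Fm → Fm → Fm
  ⟨_^_⟩_ : ℕ → Ord → Fm → Fm

worm : List (ℕ × Ord) → Fm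
worm [] = ⊤
worm ((n , a) ∷ r) = ⟨ n ^ a ⟩ worm r

mconj : List (ℕ × Ord) → Fm
mconj [] = ⊤
mconj ((n , a) ∷ []) = ⟨ n ^ a ⟩ ⊤
mconj ((n , a) ∷ p ∷ r) = ⟨ n ^ a ⟩ ⊤ ∧ mconj (p ∷ r)

data IsINF : List (ℕ × Ord) → Set where
  inf-⊤   : IsINF []
  inf-one : ∀ {n a} → Pos a → IsINF ((n , a) ∷ [])
  inf-cons : ∀ {n a m b r} → Pos a → n < m →
             IsINF ((m , b) ∷ r) → IsINF ((n , a) ∷ (m , b) ∷ r)

data IsMNF : List (ℕ × Ord) → Set where
  mnf-⊤    : IsMNF []
  mnf-mono : ∀ {n a} → IsMNF ((n , a) ∷ [])
  mnf-cons : ∀ {n a n₀ a₀ r} → IsMNF ((n₀ , a₀) ∷ r) → n < n₀ →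
             Σ Ord (λ b → a ≈o (e (n₀ ∸ n) a₀ ·o (two +o b))) →
             IsMNF ((n , a) ∷ (n₀ , a₀) ∷ r)

infix 4 _⊢_
data _⊢_ : Fm → Fm → Set where
  ax-id   : ∀ {φ} → φ ⊢ φ
  ax-⊤    : ∀ {φ} → φ ⊢ ⊤
  ax-∧₁   : ∀ {φ ψ} → φ ∧ ψ ⊢ φ
  ax-∧₂   : ∀ {φ ψ} → φ ∧ ψ ⊢ ψ
  ax-mono : ∀ {n a b φ} → b ≤o a → ⟨ n ^ a ⟩ φ ⊢ ⟨ n ^ b ⟩ φ
  ax-add₁ : ∀ {n a b φ} → ⟨ n ^ (a +o b) ⟩ φ ⊢ ⟨ n ^ b ⟩ ⟨ n ^ a ⟩ φ
  ax-add₂ : ∀ {n a b φ} → ⟨ n ^ b ⟩ ⟨ n ^ a ⟩ φ ⊢ ⟨ n ^ (a +o b) ⟩ φ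
  ax-red  : ∀ {m n a φ} → ⟨ (m Data.Nat.+ n) ^ a ⟩ φ ⊢ ⟨ m ^ e n a ⟩ φ
  ax-sch₁ : ∀ {n a n₀ a₀ r} → n < n₀ → IsMNF ((n₀ , a₀) ∷ r) →
            ⟨ n ^ a ⟩ mconj ((n₀ , a₀) ∷ r)
              ⊢ mconj ((n , e (n₀ ∸ n) a₀ ·o (one +o a)) ∷ (n₀ , a₀) ∷ r)
  ax-sch₂ : ∀ {n a n₀ a₀ r} → n < n₀ → IsMNF ((n₀ , a₀) ∷ r) →
            mconj ((n , e (n₀ ∸ n) a₀ ·o (one +o a)) ∷ (n₀ , a₀) ∷ r)
              ⊢ ⟨ n ^ a ⟩ mconj ((n₀ , a₀) ∷ r)
  -- the convention "⟨n^0⟩φ denotes φ"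
  ax-zero₁ : ∀ {n φ} → ⟨ n ^ 𝟎 ⟩ φ ⊢ φ
  ax-zero₂ : ∀ {n φ} → φ ⊢ ⟨ n ^ 𝟎 ⟩ φ
  r-∧     : ∀ {φ ψ χ} → φ ⊢ ψ → φ ⊢ χ → φ ⊢ ψ ∧ χ
  r-cut   : ∀ {φ ψ χ} → φ ⊢ ψ → ψ ⊢ χ → φ ⊢ χ
  r-nec   : ∀ {n a φ ψ} → φ ⊢ ψ → ⟨ n ^ a ⟩ φ ⊢ ⟨ n ^ a ⟩ ψ
  r-pull  : ∀ {n a m b φ ψ} → m < n → φ ⊢ ψ →
            ⟨ n ^ a ⟩ φ ∧ ⟨ m ^ (b +o one) ⟩ ψ ⊢ ⟨ n ^ a ⟩ (φ ∧ ⟨ m ^ (b +o one) ⟩ ψ)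

_≡TSC_ : Fm → Fm → Set
φ ≡TSC ψ = (φ ⊢ ψ) × (ψ ⊢ φ)

prepend : ℕ → Ord → List (ℕ × Ord) → List (ℕ × Ord)
prepend n b [] = (n , b) ∷ []
prepend n b ((m , a) ∷ r) = (n , e (m ∸ n) a ·o (one +o b)) ∷ (m , a) ∷ r

alphas : List (ℕ × Ord) → List (ℕ × Ord)
alphas [] = []
alphas ((n , b) ∷ r) = prepend n b (alphas r)

{-# OPTIONS --safe #-}
module Submission where

-- Induct on the worm from the right.  Once the tail is equivalent to an MNF
-- conjunction headed by ⟨m^α⟩⊤, the Schmerl axioms (with necessitation) rewrite
-- ⟨n^β⟩ applied to it as the conjunction extended by ⟨n^{e^{m-n}(α)·(1+β)}⟩⊤.
-- That extension is again in MNF because β > 0 gives 1 + β = 2 + β' for some β';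
-- proving this for the term representation of ordinals is the only real work.

open import Defs
open import Data.List using (List; []; _∷_)
open import Data.Nat using (ℕ; _<_; _∸_)
open import Data.Product using (Σ; _×_; _,_)
open import Relation.Binary.PropositionalEquality
  using (_≡_; _≢_; refl; sym; trans; cong; module ≡-Reasoning)

-- Lead≤ a b: b is 𝟎 or its leading exponent is at most a, i.e. b < ω^(a+1).
data Lead≤ (a : Ord) : Ord → Set where
  lead-𝟎 : Lead≤ a 𝟎
  lead-ω : ∀ {c d} → cmp a c ≢ lt → Lead≤ a (ω^ c + d)

data CNF : Ord → Set where
  cnf-𝟎 : CNF 𝟎
  cnf-ω : ∀ {a b} → CNF a → CNF b → Lead≤ a b → CNF (ω^ a + b)

lead≤-of-cmp : ∀ {a c d o} → cmp a c ≡ o → o ≢ lt → Lead≤ a (ω^ c + d)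
lead≤-of-cmp a≟c o≢lt = lead-ω (λ a<c → o≢lt (trans (sym a≟c) a<c))

⊕-lead≤ : ∀ {a x y} → Lead≤ a x → Lead≤ a y → Lead≤ a (x ⊕ y)
⊕-lead≤ lead-𝟎 ly = ly
⊕-lead≤ (lead-ω p) lead-𝟎 = lead-ω p
⊕-lead≤ (lead-ω {c} p) (lead-ω {c′} q) with cmp c c′
... | lt = lead-ω q
... | eq = lead-ω p
... | gt = lead-ω p

⊕-cnf : ∀ {x y} → CNF x → CNF y → CNF (x ⊕ y)
⊕-cnf cnf-𝟎 cy = cy
⊕-cnf cx@(cnf-ω _ _ _) cnf-𝟎 = cx
⊕-cnf {ω^ a + b} {ω^ c + d} (cnf-ω ca cb lb) cy@(cnf-ω _ _ _) with cmp a c in a≟c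
... | lt = cy
... | eq = cnf-ω ca (⊕-cnf cb cy) (⊕-lead≤ lb (lead≤-of-cmp a≟c λ ()))
... | gt = cnf-ω ca (⊕-cnf cb cy) (⊕-lead≤ lb (lead≤-of-cmp a≟c λ ()))

nf-cnf : ∀ a → CNF (nf a)
nf-cnf 𝟎 = cnf-𝟎
nf-cnf (ω^ a + b) = ⊕-cnf (cnf-ω (nf-cnf a) cnf-𝟎 lead-𝟎) (nf-cnf b)

ω^-⊕-lead≤ : ∀ {a b} → Lead≤ a b → (ω^ a + 𝟎) ⊕ b ≡ ω^ a + b
ω^-⊕-lead≤ lead-𝟎 = refl
ω^-⊕-lead≤ {a} (lead-ω {c} a≮c) with cmp a c
... | lt with () ← a≮c refl
... | eq = refl
... | gt = refl

nf-fixes-CNF : ∀ {x} → CNF x → nf x ≡ x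
nf-fixes-CNF cnf-𝟎 = refl
nf-fixes-CNF {ω^ a + b} (cnf-ω ca cb lb)
  rewrite nf-fixes-CNF ca | nf-fixes-CNF cb = ω^-⊕-lead≤ lb

-- If x begins with ω^c for c > 0, then 1 + x = x = 2 + x; otherwise x = 1 + y
-- and 1 + x = 2 + y.
one⊕≡two⊕ : ∀ {x} → CNF x → x ≢ 𝟎 → Σ Ord λ y → CNF y × (one ⊕ x ≡ two ⊕ y)
one⊕≡two⊕ {𝟎} _ x≢𝟎 with () ← x≢𝟎 refl
one⊕≡two⊕ {ω^ ω^ _ + _ + _} cx _ = _ , cx , refl
one⊕≡two⊕ {ω^ 𝟎 + 𝟎} _ _ = 𝟎 , cnf-𝟎 , refl
one⊕≡two⊕ {ω^ 𝟎 + (ω^ 𝟎 + _)} (cnf-ω _ cy _) _ = _ , cy , refl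
one⊕≡two⊕ {ω^ 𝟎 + (ω^ ω^ _ + _ + _)} (cnf-ω _ _ (lead-ω 𝟎≮c)) _ with () ← 𝟎≮c refl

one+o≈two+o : ∀ a → Pos a → Σ Ord λ b → (one +o a) ≈o (two +o b)
one+o≈two+o a a>0 with one⊕≡two⊕ (nf-cnf a) a>0
... | b , cb , 1+a≡2+b = b , (begin
  nf (one ⊕ nf a)  ≡⟨ nf-fixes-CNF (⊕-cnf (nf-cnf one) (nf-cnf a)) ⟩
  one ⊕ nf a       ≡⟨ 1+a≡2+b ⟩
  two ⊕ b          ≡⟨ cong (two ⊕_) (sym (nf-fixes-CNF cb)) ⟩
  two ⊕ nf b       ≡⟨ sym (nf-fixes-CNF (⊕-cnf (nf-cnf two) (nf-cnf b))) ⟩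
  nf (two ⊕ nf b)  ∎)
  where open ≡-Reasoning

·o-congʳ : ∀ a {b c} → b ≈o c → (a ·o b) ≈o (a ·o c)
·o-congʳ a b≈c = cong (λ z → nf (nf a ⊗ z)) b≈c

schmerl-step : ∀ {n β m α r φ} → Pos β → n < m → IsMNF ((m , α) ∷ r) →
  φ ≡TSC mconj ((m , α) ∷ r) →
  let ψ = (n , e (m ∸ n) α ·o (one +o β)) ∷ (m , α) ∷ r
  in IsMNF ψ × ((⟨ n ^ β ⟩ φ) ≡TSC mconj ψ)
schmerl-step {n} {β} {m} {α} β>0 n<m mnf (φ⊢ψ , ψ⊢φ) with one+o≈two+o β β>0
... | β′ , 1+β≈2+β′ =
  mnf-cons mnf n<m (β′ , ·o-congʳ (e (m ∸ n) α) {one +o β} {two +o β′} 1+β≈2+β′) ,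
  r-cut (r-nec φ⊢ψ) (ax-sch₁ n<m mnf) ,
  r-cut (ax-sch₂ n<m mnf) (r-nec ψ⊢φ)

-- The identical clauses are not redundant: splitting on X exposes the head of
-- prepend m β₁ X, which the outer prepend needs in order to compute.
prepend-step : ∀ {n β m β₁ φ} X → Pos β → n < m →
  IsMNF (prepend m β₁ X) × (φ ≡TSC mconj (prepend m β₁ X)) →
  let ψ = prepend n β (prepend m β₁ X)
  in IsMNF ψ × ((⟨ n ^ β ⟩ φ) ≡TSC mconj ψ)
prepend-step []      β>0 n<m (mnf , φ≡ψ) = schmerl-step β>0 n<m mnf φ≡ψ
prepend-step (_ ∷ _) β>0 n<m (mnf , φ≡ψ) = schmerl-step β>0 n<m mnf φ≡ψ

theorem5p2 : (w : List (ℕ × Ord)) → IsINF w →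
    IsMNF (alphas w) × (worm w ≡TSC mconj (alphas w))
theorem5p2 [] _ = mnf-⊤ , ax-id , ax-id
theorem5p2 ((n , β) ∷ []) _ = mnf-mono , ax-id , ax-id
theorem5p2 ((n , β) ∷ (m , β₁) ∷ r) (inf-cons β>0 n<m inf) =
  prepend-step (alphas r) β>0 n<m (theorem5p2 ((m , β₁) ∷ r) inf)
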